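{- Let $\ell\ge1$, let $\mathcal{T}$ be an $\ell$-index-tree, and let $i,b\in\{1,\dots,\ell\}$ with $i<b$. Then all factors of the word $B(\ell)$ that start with the letter $b$, end with the letter $b$, contain at least one occurrence of $i$, and contain no other occurrence of $b$, are equal (as words).
   Context: A partial binary tree is a rooted tree in which every node has at most one left child and at most one right child. An $\ell$-index-tree is a partial binary tree whose vertices (indices) are $1,\dots,\ell$, labelled so that in the depth-first preorder traversal from the root visiting left children before right children, the $k$-th visited node gets label $\ell+1-k$. For an index $i$, $i^-$, $i^+$ are its left and right children. Words are finite sequences of letters; $\circ$ denotes concatenation; a factor of a word is a contiguous subword. The full index-barrier $B(i)$ is defined recursively by: $B(i)=i$ if $i$ is a leaf; $B(i)=i\circ B(i-1)\circ i$ if $i$ has exactly one child (necessarily $i-1$); and $B(i)=i\circ B(i^-)\circ i\circ B(i^+)\circ i\circ B(i^-)\circ i$ if $i$ has two children. -}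

module Defs where

open import Data.Nat using (ℕ; zero; suc; _+_; _∸_)
open import Data.Maybe using (Maybe; nothing; just)
open import Data.List using (List; []; _∷_; _++_; [_])
open import Data.List.Membership.Propositional using (_∈_; _∉_)
open import Data.Product using (Σ; ∃; _×_; _,_)
open import Relation.Binary.PropositionalEquality using (_≡_)

data PBT : Set where
  node : Maybe PBT → Maybe PBT → PBT

size : PBT → ℕ
msize : Maybe PBT → ℕ
size (node l r) = suc (msize l + msize r)
msize nothing  = 0
msize (just t) = size t

-- An ℓ-index-tree: a partial binary tree with exactly ℓ nodes, labelled by
-- reverse preorder (root, left subtree, right subtree): the k-th visited
-- node gets label ℓ+1-k.  Hence if a node has label n, its left child has
-- label n-1 and its right child has label n-1-(size of left subtree).
IndexTree : ℕ → Set
IndexTree ℓ = Σ PBT λ t → size t ≡ ℓ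

-- Full index-barrier B(n) of the node with label n whose subtree is t.
barrier : PBT → ℕ → List ℕ
barrier (node nothing nothing) n = [ n ]
barrier (node (just l) nothing) n = n ∷ barrier l (n ∸ 1) ++ [ n ]
barrier (node nothing (just r)) n = n ∷ barrier r (n ∸ 1) ++ [ n ]
barrier (node (just l) (just r)) n =
  n ∷ barrier l (n ∸ 1) ++ n ∷ barrier r (n ∸ 1 ∸ size l)
    ++ n ∷ barrier l (n ∸ 1) ++ [ n ]

fullBarrier : {ℓ : ℕ} → IndexTree ℓ → List ℕ
fullBarrier {ℓ} (t , _) = barrier t ℓ

Factor : List ℕ → List ℕ → Set
Factor u w = ∃ λ (xs : List ℕ) → ∃ λ (ys : List ℕ) → xs ++ u ++ ys ≡ w

-- u starts with b, ends with b, contains no other occurrence of b,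
-- and contains at least one occurrence of i.
-- (A one-letter word [b] cannot contain i when i ≠ b, so such u has length ≥ 2
--  and is of the form b ∷ m ++ [ b ] with b ∉ m.)
BFactor : ℕ → ℕ → List ℕ → Set
BFactor b i u = (∃ λ (m : List ℕ) → (u ≡ b ∷ m ++ [ b ]) × (b ∉ m)) × (i ∈ u)

{-# OPTIONS --safe #-}
-- A barrier is built from singletons by sandwiching: the barrier of a node n
-- is [ n ] ++ C ++ [ n ] if its only child has barrier C, and D ++ B ++ D with
-- D = [ n ] ++ A ++ [ n ] if its children have barriers A and B; in both cases
-- every letter of the middle part is smaller than every letter of the outer part.
-- Sandwiching D ++ B ++ D with B below D preserves three properties: the
-- letters before the first and after the last b all exceed b, and the b-gaps
-- containing a fixed letter i < b coincide.  For the last one: if b ∈ B every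
-- b-gap lies in B; otherwise a b-gap lies in D or is the single gap s ++ B ++ p
-- crossing B, and a letter i < b of that gap cannot lie in s or p, so it lies
-- in B and hence not in D.
module Submission where

open import Defs
open import Data.Nat using (ℕ; suc; _+_; _≤_; _<_; s≤s)
open import Data.Nat.Properties
  using (≤-refl; <⇒≤; ≤-trans; ≤-<-trans; <-asym; <-irrefl; ≤-reflexive;
         m≤n+m; +-monoˡ-≤; +-assoc; +-identityʳ; m+n∸m≡n; _≟_)
open import Data.Maybe using (nothing; just)
open import Data.List using (List; []; _∷_; _++_; [_])
open import Data.List.Properties using (∷-injective; ++-assoc; ++-conicalʳ)
open import Data.List.Membership.Propositional using (_∈_; _∉_)
open import Data.List.Membership.Propositional.Properties using (∈-++⁺ˡ; ∈-++⁺ʳ; ∈-++⁻)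
open import Data.List.Membership.DecPropositional _≟_ using (_∈?_)
open import Data.List.Relation.Binary.Subset.Propositional using (_⊆_)
open import Data.List.Relation.Unary.All as All using (All; []; _∷_)
open import Data.List.Relation.Unary.All.Properties using (++⁺)
open import Data.List.Relation.Unary.Any using (here; there)
open import Data.Product as Product using (∃; ∃₂; _×_; _,_; proj₂)
open import Data.Sum as Sum using (_⊎_; inj₁; inj₂)
open import Data.Empty using (⊥-elim)
open import Function using (_∘_)
open import Relation.Nullary using (yes; no)
open import Relation.Binary.PropositionalEquality
  using (_≡_; refl; sym; trans; cong; cong₂; subst)

module _ {a} {A : Set a} where

  ++-equidivisible : ∀ (xs ys ps qs : List A) → xs ++ ys ≡ ps ++ qs →
    (∃ λ rs → ps ≡ xs ++ rs × ys ≡ rs ++ qs) ⊎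
    (∃₂ λ r rs → xs ≡ ps ++ r ∷ rs × qs ≡ r ∷ rs ++ ys)
  ++-equidivisible []       ys ps       qs eq = inj₁ (ps , refl , eq)
  ++-equidivisible (x ∷ xs) ys []       qs eq = inj₂ (x , xs , refl , sym eq)
  ++-equidivisible (x ∷ xs) ys (p ∷ ps) qs eq with ∷-injective eq
  ... | refl , eq′ =
    Sum.map (Product.map₂ (Product.map₁ (cong (x ∷_))))
            (Product.map₂ (Product.map₂ (Product.map₁ (cong (x ∷_)))))
            (++-equidivisible xs ys ps qs eq′)

  After : A → List A → List A → Set a
  After b w s = (∃ λ xs → w ≡ xs ++ b ∷ s) × b ∉ s

  Before : A → List A → List A → Set a
  Before b w p = (∃ λ ys → w ≡ p ++ b ∷ ys) × b ∉ p

  Gap : A → List A → List A → Set a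
  Gap b w m = ∃₂ λ X Y → w ≡ X ++ b ∷ Y × After b X m

  Straddle : A → List A → List A → List A → Set a
  Straddle b X Y m = ∃₂ λ s p → m ≡ s ++ p × After b X s × Before b Y p

module _ {a} {A : Set a} {b : A} where

  after-∈ : ∀ {w s} → After b w s → b ∈ w
  after-∈ ((xs , refl) , _) = ∈-++⁺ʳ xs (here refl)

  before-∈ : ∀ {w p} → Before b w p → b ∈ w
  before-∈ {p = p} ((_ , refl) , _) = ∈-++⁺ʳ p (here refl)

  gap-∈ : ∀ {w m} → Gap b w m → b ∈ w
  gap-∈ (X , _ , refl , _) = ∈-++⁺ʳ X (here refl)

  gap-⊆ : ∀ {w m} → Gap b w m → m ⊆ w
  gap-⊆ (_ , _ , refl , (xs , refl) , _) x∈m = ∈-++⁺ˡ (∈-++⁺ʳ xs (there x∈m))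

  after-unique : ∀ {w s t} → After b w s → After b w t → s ≡ t
  after-unique {s = s} {t} ((xs , refl) , b∉s) ((ys , eq) , b∉t)
    with ++-equidivisible xs (b ∷ s) ys (b ∷ t) eq
  ... | inj₁ ([] , _ , refl) = refl
  ... | inj₁ (_ ∷ rs , _ , refl) = ⊥-elim (b∉s (∈-++⁺ʳ rs (here refl)))
  ... | inj₂ (_ , rs , _ , refl) = ⊥-elim (b∉t (∈-++⁺ʳ rs (here refl)))

  before-unique : ∀ {w p q} → Before b w p → Before b w q → p ≡ q
  before-unique ((_ , refl) , b∉p) ((_ , eq) , b∉q) = go b∉p b∉q eq
    where
    go : ∀ {p q ys zs} → b ∉ p → b ∉ q → p ++ b ∷ ys ≡ q ++ b ∷ zs → p ≡ q
    go {[]}    {[]}    _   _   _  = refl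
    go {[]}    {_ ∷ _} _   b∉q refl = ⊥-elim (b∉q (here refl))
    go {_ ∷ _} {[]}    b∉p _   refl = ⊥-elim (b∉p (here refl))
    go {_ ∷ _} {_ ∷ _} b∉p b∉q eq with ∷-injective eq
    ... | refl , eq′ = cong (_ ∷_) (go (b∉p ∘ there) (b∉q ∘ there) eq′)

  after-++ : ∀ X Y {s} → After b (X ++ Y) s →
    After b Y s ⊎ ∃ λ s₁ → s ≡ s₁ ++ Y × After b X s₁
  after-++ X Y {s} ((xs , eq) , b∉s) with ++-equidivisible X Y xs (b ∷ s) eq
  ... | inj₁ (rs , _ , Y≡) = inj₁ ((rs , Y≡) , b∉s)
  ... | inj₂ (_ , rs , X≡ , refl) = inj₂ (rs , refl , (xs , X≡) , b∉s ∘ ∈-++⁺ˡ)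

  before-++ : ∀ X Y {p} → Before b (X ++ Y) p →
    Before b X p ⊎ ∃ λ p₂ → p ≡ X ++ p₂ × Before b Y p₂
  before-++ X Y {p} ((ys , eq) , b∉p) with ++-equidivisible X Y p (b ∷ ys) eq
  ... | inj₁ (rs , refl , Y≡) = inj₂ (rs , refl , (ys , Y≡) , b∉p ∘ ∈-++⁺ʳ X)
  ... | inj₂ (_ , rs , X≡ , refl) = inj₁ ((rs , X≡) , b∉p)

  gap-++ : ∀ X Y {m} → Gap b (X ++ Y) m → Gap b X m ⊎ Gap b Y m ⊎ Straddle b X Y m
  gap-++ X Y (X′ , Y′ , eq , after) with ++-equidivisible X Y X′ (b ∷ Y′) eq
  ... | inj₂ (_ , rs , X≡ , refl) = inj₁ (X′ , rs , X≡ , after)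
  ... | inj₁ (rs , refl , Y≡) with after-++ X rs after
  ...   | inj₁ after′ = inj₂ (inj₁ (rs , Y′ , Y≡ , after′))
  ...   | inj₂ (s , refl , afterX) =
          inj₂ (inj₂ (s , rs , refl , afterX , (Y′ , Y≡) , proj₂ after ∘ ∈-++⁺ʳ s))

  gap-sandwich-middle : ∀ {D B m} → b ∉ D → Gap b (D ++ B ++ D) m → Gap b B m
  gap-sandwich-middle {D} {B} b∉D gap with gap-++ D (B ++ D) gap
  ... | inj₁ gapD = ⊥-elim (b∉D (gap-∈ gapD))
  ... | inj₂ (inj₂ (_ , _ , _ , afterD , _)) = ⊥-elim (b∉D (after-∈ afterD))
  ... | inj₂ (inj₁ gapBD) with gap-++ B D gapBD
  ...   | inj₁ gapB = gapB
  ...   | inj₂ (inj₁ gapD) = ⊥-elim (b∉D (gap-∈ gapD))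
  ...   | inj₂ (inj₂ (_ , _ , _ , _ , beforeD)) = ⊥-elim (b∉D (before-∈ beforeD))

  gap-sandwich-outer : ∀ {D B m} → b ∉ B → Gap b (D ++ B ++ D) m →
    Gap b D m ⊎ ∃₂ λ s p → m ≡ s ++ B ++ p × After b D s × Before b D p
  gap-sandwich-outer {D} {B} b∉B gap with gap-++ D (B ++ D) gap
  ... | inj₁ gapD = inj₁ gapD
  ... | inj₂ (inj₁ gapBD) with gap-++ B D gapBD
  ...   | inj₁ gapB = ⊥-elim (b∉B (gap-∈ gapB))
  ...   | inj₂ (inj₁ gapD) = inj₁ gapD
  ...   | inj₂ (inj₂ (_ , _ , _ , afterB , _)) = ⊥-elim (b∉B (after-∈ afterB))
  gap-sandwich-outer {D} {B} b∉B gap | inj₂ (inj₂ (s , p , refl , afterD , beforeBD))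
    with before-++ B D beforeBD
  ... | inj₁ beforeB = ⊥-elim (b∉B (before-∈ beforeB))
  ... | inj₂ (p₂ , refl , beforeD) = inj₂ (s , p₂ , refl , afterD , beforeD)

record BarrierLike (w : List ℕ) : Set where
  field
    after-last-above   : ∀ {b s} → After b w s → All (b <_) s
    before-first-above : ∀ {b p} → Before b w p → All (b <_) p
    gaps-unique        : ∀ {i b m m′} → i < b → Gap b w m → i ∈ m → Gap b w m′ → i ∈ m′ → m ≡ m′

open BarrierLike

barrierLike-[_] : ∀ n → BarrierLike [ n ]
barrierLike-[ n ] .after-last-above (([] , refl) , _) = []
barrierLike-[ n ] .after-last-above ((_ ∷ [] , ()) , _)
barrierLike-[ n ] .after-last-above ((_ ∷ _ ∷ _ , ()) , _)
barrierLike-[ n ] .before-first-above {p = []} _ = []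
barrierLike-[ n ] .before-first-above {p = _ ∷ []} ((_ , ()) , _)
barrierLike-[ n ] .before-first-above {p = _ ∷ _ ∷ _} ((_ , ()) , _)
barrierLike-[ n ] .gaps-unique _ ([] , _ , _ , ((xs , eq) , _)) with () ← ++-conicalʳ xs _ (sym eq)
barrierLike-[ n ] .gaps-unique _ (_ ∷ [] , _ , () , _)
barrierLike-[ n ] .gaps-unique _ (_ ∷ _ ∷ _ , _ , () , _)

module _ {D B : List ℕ} (c : ℕ) (B≤c : All (_≤ c) B) (c<D : All (c <_) D)
         (D-barrierLike : BarrierLike D) (B-barrierLike : BarrierLike B) where

  private
    module D = BarrierLike D-barrierLike
    module B = BarrierLike B-barrierLike

    below-D : ∀ {x} → x ∈ B → All (x <_) D
    below-D x∈B = All.map (≤-<-trans (All.lookup B≤c x∈B)) c<D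

    ∈B⇒∉D : ∀ {x} → x ∈ B → x ∉ D
    ∈B⇒∉D x∈B x∈D = <-irrefl refl (All.lookup (below-D x∈B) x∈D)

    crossing-in-middle : ∀ {i b s p} → i < b → After b D s → Before b D p → i ∈ s ++ B ++ p → i ∈ B
    crossing-in-middle {s = s} i<b afterD beforeD i∈ with ∈-++⁻ s i∈
    ... | inj₁ i∈s = ⊥-elim (<-asym i<b (All.lookup (D.after-last-above afterD) i∈s))
    ... | inj₂ i∈Bp with ∈-++⁻ B i∈Bp
    ...   | inj₁ i∈B = i∈B
    ...   | inj₂ i∈p = ⊥-elim (<-asym i<b (All.lookup (D.before-first-above beforeD) i∈p))

  barrierLike-sandwich : BarrierLike (D ++ B ++ D)
  barrierLike-sandwich .after-last-above after with after-++ D (B ++ D) after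
  ... | inj₂ (s₁ , refl , afterD) = ⊥-elim (proj₂ after (∈-++⁺ʳ s₁ (∈-++⁺ʳ B (after-∈ afterD))))
  ... | inj₁ afterBD with after-++ B D afterBD
  ...   | inj₁ afterD = D.after-last-above afterD
  ...   | inj₂ (_ , refl , afterB) = ++⁺ (B.after-last-above afterB) (below-D (after-∈ afterB))
  barrierLike-sandwich .before-first-above before with before-++ D (B ++ D) before
  ... | inj₁ beforeD = D.before-first-above beforeD
  ... | inj₂ (_ , refl , beforeBD) with before-++ B D beforeBD
  ...   | inj₁ beforeB = ++⁺ (below-D (before-∈ beforeB)) (B.before-first-above beforeB)
  ...   | inj₂ (_ , refl , beforeD) = ⊥-elim (proj₂ before (∈-++⁺ˡ (before-∈ beforeD)))
  barrierLike-sandwich .gaps-unique {b = b} i<b gap i∈m gap′ i∈m′ with b ∈? B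
  ... | yes b∈B = B.gaps-unique i<b (gap-sandwich-middle (∈B⇒∉D b∈B) gap) i∈m
                                    (gap-sandwich-middle (∈B⇒∉D b∈B) gap′) i∈m′
  ... | no b∉B with gap-sandwich-outer b∉B gap | gap-sandwich-outer b∉B gap′
  ...   | inj₁ gapD | inj₁ gapD′ = D.gaps-unique i<b gapD i∈m gapD′ i∈m′
  ...   | inj₁ gapD | inj₂ (_ , _ , refl , afterD , beforeD) =
          ⊥-elim (∈B⇒∉D (crossing-in-middle i<b afterD beforeD i∈m′) (gap-⊆ gapD i∈m))
  ...   | inj₂ (_ , _ , refl , afterD , beforeD) | inj₁ gapD′ =
          ⊥-elim (∈B⇒∉D (crossing-in-middle i<b afterD beforeD i∈m) (gap-⊆ gapD′ i∈m′))
  ...   | inj₂ (_ , _ , refl , afterD , beforeD) | inj₂ (_ , _ , refl , afterD′ , beforeD′) =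
          cong₂ (λ s p → s ++ B ++ p) (after-unique afterD afterD′) (before-unique beforeD beforeD′)

module _ {a p} {A : Set a} {P : A → Set p} where

  All-sandwich : ∀ {D B} → All P D → All P B → All P (D ++ B ++ D)
  All-sandwich PD PB = ++⁺ PD (++⁺ PB PD)

  All-wrap : ∀ {n w} → P n → All P w → All P ([ n ] ++ w ++ [ n ])
  All-wrap Pn = All-sandwich (Pn ∷ [])

All-≤-weaken : ∀ {m n w} → m ≤ n → All (_≤ m) w → All (_≤ n) w
All-≤-weaken m≤n = All.map (λ x≤m → ≤-trans x≤m m≤n)

-- The barrier of the subtree t whose nodes carry the labels lo + 1, …, lo + size t.
offsetBarrier : PBT → ℕ → List ℕ
offsetBarrier t lo = barrier t (size t + lo)

offsetBarrier-left : ∀ l lo → let n = size (node (just l) nothing) + lo in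
  offsetBarrier (node (just l) nothing) lo ≡ [ n ] ++ offsetBarrier l lo ++ [ n ]
offsetBarrier-left l lo rewrite +-identityʳ (size l) = refl

offsetBarrier-both : ∀ l r lo → let n = size (node (just l) (just r)) + lo
                                    D = n ∷ offsetBarrier l (size r + lo) ++ [ n ] in
  offsetBarrier (node (just l) (just r)) lo ≡ D ++ offsetBarrier r lo ++ D
offsetBarrier-both l r lo
  rewrite +-assoc (size l) (size r) lo | m+n∸m≡n (size l) (size r + lo) =
  cong (suc (size l + (size r + lo)) ∷_) (sym (++-assoc (offsetBarrier l (size r + lo)) _ _))

root-above : ∀ l r lo → lo < size (node l r) + lo
root-above l r lo = s≤s (m≤n+m lo (msize l + msize r))

left-below-root : ∀ l r lo → msize l + (msize r + lo) < size (node l r) + lo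
left-below-root l r lo = s≤s (≤-reflexive (sym (+-assoc (msize l) (msize r) lo)))

right-below-root : ∀ l r lo → msize r + lo < size (node l r) + lo
right-below-root l r lo = s≤s (+-monoˡ-≤ lo (m≤n+m (msize r) (msize l)))

offsetBarrier-above : ∀ t lo → All (lo <_) (offsetBarrier t lo)
offsetBarrier-above (node nothing nothing) lo = ≤-refl ∷ []
offsetBarrier-above (node (just l) nothing) lo =
  subst (All (lo <_)) (sym (offsetBarrier-left l lo))
    (All-wrap (root-above (just l) nothing lo) (offsetBarrier-above l lo))
offsetBarrier-above (node nothing (just r)) lo =
  All-wrap (root-above nothing (just r) lo) (offsetBarrier-above r lo)
offsetBarrier-above (node (just l) (just r)) lo =
  subst (All (lo <_)) (sym (offsetBarrier-both l r lo))
    (All-sandwich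
      (All-wrap (root-above (just l) (just r) lo)
                (All.map (≤-<-trans (m≤n+m lo (size r))) (offsetBarrier-above l (size r + lo))))
      (offsetBarrier-above r lo))

offsetBarrier-below : ∀ t lo → All (_≤ size t + lo) (offsetBarrier t lo)
offsetBarrier-below (node nothing nothing) lo = ≤-refl ∷ []
offsetBarrier-below (node (just l) nothing) lo =
  subst (All (_≤ size (node (just l) nothing) + lo)) (sym (offsetBarrier-left l lo))
    (All-wrap ≤-refl (All-≤-weaken (<⇒≤ (left-below-root (just l) nothing lo)) (offsetBarrier-below l lo)))
offsetBarrier-below (node nothing (just r)) lo =
  All-wrap ≤-refl (All-≤-weaken (<⇒≤ (right-below-root nothing (just r) lo)) (offsetBarrier-below r lo))
offsetBarrier-below (node (just l) (just r)) lo =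
  subst (All (_≤ size (node (just l) (just r)) + lo)) (sym (offsetBarrier-both l r lo))
    (All-sandwich
      (All-wrap ≤-refl (All-≤-weaken (<⇒≤ (left-below-root (just l) (just r) lo))
                                     (offsetBarrier-below l (size r + lo))))
      (All-≤-weaken (<⇒≤ (right-below-root (just l) (just r) lo)) (offsetBarrier-below r lo)))

offsetBarrier-barrierLike : ∀ t lo → BarrierLike (offsetBarrier t lo)
offsetBarrier-barrierLike (node nothing nothing) lo = barrierLike-[ suc lo ]
offsetBarrier-barrierLike (node (just l) nothing) lo =
  subst BarrierLike (sym (offsetBarrier-left l lo))
    (barrierLike-sandwich (size l + lo) (offsetBarrier-below l lo)
      (left-below-root (just l) nothing lo ∷ []) barrierLike-[ _ ] (offsetBarrier-barrierLike l lo))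
offsetBarrier-barrierLike (node nothing (just r)) lo =
  barrierLike-sandwich (size r + lo) (offsetBarrier-below r lo)
    (right-below-root nothing (just r) lo ∷ []) barrierLike-[ _ ] (offsetBarrier-barrierLike r lo)
offsetBarrier-barrierLike (node (just l) (just r)) lo =
  subst BarrierLike (sym (offsetBarrier-both l r lo))
    (barrierLike-sandwich (size r + lo) (offsetBarrier-below r lo)
      (All-wrap (right-below-root (just l) (just r) lo) (offsetBarrier-above l (size r + lo)))
      (barrierLike-sandwich (size l + (size r + lo)) (offsetBarrier-below l (size r + lo))
        (left-below-root (just l) (just r) lo ∷ []) barrierLike-[ _ ] (offsetBarrier-barrierLike l (size r + lo)))
      (offsetBarrier-barrierLike r lo))

barrier-barrierLike : ∀ t → BarrierLike (barrier t (size t))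
barrier-barrierLike t =
  subst (λ n → BarrierLike (barrier t n)) (+-identityʳ (size t)) (offsetBarrier-barrierLike t 0)

bFactor-gap : ∀ {b i u w} → i < b → Factor u w → BFactor b i u →
  ∃ λ m → u ≡ b ∷ m ++ [ b ] × Gap b w m × i ∈ m
bFactor-gap {b} {i} i<b (xs , ys , refl) ((m , refl , b∉m) , i∈u) =
  m , refl , (xs ++ b ∷ m , ys , regroup , (xs , refl) , b∉m) , i∈m i∈u
  where
  regroup : xs ++ (b ∷ m ++ [ b ]) ++ ys ≡ (xs ++ b ∷ m) ++ b ∷ ys
  regroup = trans (cong (λ z → xs ++ b ∷ z) (++-assoc m [ b ] ys)) (sym (++-assoc xs (b ∷ m) (b ∷ ys)))

  i∈m : i ∈ b ∷ m ++ [ b ] → i ∈ m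
  i∈m (here i≡b) = ⊥-elim (<-irrefl i≡b i<b)
  i∈m (there i∈m++[b]) with ∈-++⁻ m i∈m++[b]
  ... | inj₁ i∈m′ = i∈m′
  ... | inj₂ (here i≡b) = ⊥-elim (<-irrefl i≡b i<b)

proposition3p13 : (ℓ : ℕ) → 1 ≤ ℓ → (T : IndexTree ℓ) → (i b : ℕ) →
    1 ≤ i → i < b → b ≤ ℓ → (u v : List ℕ) →
    Factor u (fullBarrier T) → BFactor b i u →
    Factor v (fullBarrier T) → BFactor b i v →
    u ≡ v
proposition3p13 .(size t) _ (t , refl) i b _ i<b _ u v factor-u bFactor-u factor-v bFactor-v
  with bFactor-gap i<b factor-u bFactor-u | bFactor-gap i<b factor-v bFactor-v
... | m , refl , gap , i∈m | m′ , refl , gap′ , i∈m′ =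
  cong (λ x → b ∷ x ++ [ b ]) (gaps-unique (barrier-barrierLike t) i<b gap i∈m gap′ i∈m′)
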